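{- Let $S,T\subseteq[\Delta]^2$ be multisets with $|S|=|T|=n$, no point of $S$ sharing a location with a point of $T$, and let $k$ be the minimum of the number of distinct points of $S$ and the number of distinct points of $T$. For each level $i=0,\ldots,\log\Delta$ and each $j=1,\ldots,2\log\Delta$, let $G_i^j$ be a grid of cell size $2^i$ shifted by a random vector chosen uniformly at random (with half-integral coordinates), all shift vectors being independent. Let $C_i^j=\|V_{G_i^j}(S)-V_{G_i^j}(T)\|_1$, $C_i=\min_j C_i^j$, and $Y=\frac12\sum_{i=0}^{\log\Delta}2^i C_i$. Then with high probability, $Y\le O(k)\cdot EMD(S,T)$.
   Context: $[\Delta]=\{1,\ldots,\Delta\}$ and logarithms are base 2. For multisets $S,T$ with $|S|=|T|=n$, $EMD(S,T)=\min_{\pi:S\to T}\sum_{a\in S}\|a-\pi(a)\|_1$ over bijections $\pi$. A grid of cell size $2^i$ is the family of square cells of side length $2^i$ obtained from the axis-parallel grid with lines at coordinates that are multiples of $2^i$ (fixed at the origin) by translating it by a shift vector; shift vectors have half-integral coordinates (in $\{\ldots,-\tfrac12,\tfrac12,\tfrac32,\ldots\}$), so that all grid lines have half-integral coordinates and no point of $[\Delta]^2$ lies on a grid line. For a grid $G$ and multiset $S\subseteq[\Delta]^2$, the characteristic vector $V_G(S)$ has one coordinate for each cell of $G$ intersecting $(0,\Delta)^2$, whose value is the number of points of $S$ (with multiplicity) in that cell. "With high probability" means with probability $1-o(1)$. -}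

module Defs where

open import Data.Nat using (ℕ; zero; suc; _+_; _*_; _∸_; _^_; _≤_; _⊓_; ∣_-_∣; _/_; _≤?_)
open import Data.Nat.Properties using (m^n≢0; _≟_)
open import Data.Fin using (Fin; toℕ) renaming (zero to fzero; suc to fsuc)
open import Data.Fin.Permutation using (Permutation′; _⟨$⟩ʳ_)
open import Data.Product using (_×_; _,_; Σ-syntax)
open import Data.Product.Properties using (≡-dec)
open import Data.List using (List; []; _∷_; [_]; map; concatMap; length; filter; foldr; upTo; allFin; deduplicate)
open import Data.Vec using (Vec; lookup; toList)
open import Data.Nat.ListAction using (sum)
open import Relation.Binary.PropositionalEquality using (_≡_; _≢_)
open import Relation.Binary.Definitions using (DecidableEquality)
open import Relation.Nullary using (¬?)

Point : Set
Point = ℕ × ℕ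

_≟P_ : DecidableEquality Point
_≟P_ = ≡-dec _≟_ _≟_

InGrid : ℕ → Point → Set
InGrid Δ (x , y) = (1 ≤ x × x ≤ Δ) × (1 ≤ y × y ≤ Δ)

-- A multiset of size n is a vector of n points (order irrelevant,
-- repetitions = multiplicity).

distinct : ∀ {n} → Vec Point n → ℕ
distinct S = length (deduplicate _≟P_ (toList S))

dist₁ : Point → Point → ℕ
dist₁ (x , y) (x' , y') = ∣ x - x' ∣ + ∣ y - y' ∣

matchCost : ∀ {n} → Vec Point n → Vec Point n → Permutation′ n → ℕ
matchCost {n} S T π = sum (map (λ a → dist₁ (lookup S a) (lookup T (π ⟨$⟩ʳ a))) (allFin n))

IsEMD : ∀ {n} → Vec Point n → Vec Point n → ℕ → Set
IsEMD {n} S T d = (Σ[ π ∈ Permutation′ n ] matchCost S T π ≡ d)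
                × ((π : Permutation′ n) → d ≤ matchCost S T π)

-- Grid of cell size 2^i shifted by (sx + 1/2 , sy + 1/2), with
-- 0 ≤ sx, sy < 2^i (shifts are taken modulo the period 2^i).
-- Its vertical lines are at x = m·2^i + sx + 1/2 (m ∈ ℤ).  The integer x
-- lies in the cell with index ⌊(x - sx - 1)/2^i⌋; we use the index
-- ⌊(x + 2^i - sx - 1)/2^i⌋ (the same cell, index shifted by +1, so it is
-- a natural number when x ≥ 1).
cellIndex : (i s x : ℕ) → ℕ
cellIndex i s x = _/_ (x + 2 ^ i ∸ suc s) (2 ^ i) {{m^n≢0 2 i}}

cellOf : (i sx sy : ℕ) → Point → Point
cellOf i sx sy (x , y) = (cellIndex i sx x , cellIndex i sy y)

cellCount : ∀ {n} (i sx sy : ℕ) → Vec Point n → Point → ℕ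
cellCount i sx sy S c = length (filter (λ p → cellOf i sx sy p ≟P c) (toList S))

-- The cells meeting (0,Δ)^2 have indices in
-- {0,…,2^(L-i)+1}^2 (cells in this range not meeting (0,Δ)^2 contain no
-- point of [Δ]^2 and contribute 0).
gridDiff : ∀ {n} (L i sx sy : ℕ) → Vec Point n → Vec Point n → ℕ
gridDiff L i sx sy S T =
  sum (map (λ u → sum (map (λ v →
         ∣ cellCount i sx sy S (u , v) - cellCount i sx sy T (u , v) ∣)
       range)) range)
  where range = upTo (2 ^ (L ∸ i) + 2)

-- A choice of all shift vectors for Δ = 2^L: for each level
-- i ∈ {0..L} and each j ∈ {1..2L} (encoded as Fin (2L)), a shift in
-- {0..2^i-1}^2 (standing for half-integral shifts modulo 2^i).
Shifts : ℕ → Set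
Shifts L = (i : Fin (suc L)) → Fin (2 * L) → Fin (2 ^ toℕ i) × Fin (2 ^ toℕ i)

allDep : (n : ℕ) (B : Fin n → Set) → ((k : Fin n) → List (B k)) → List ((k : Fin n) → B k)
allDep zero B e = [ (λ ()) ]
allDep (suc n) B e =
  concatMap (λ b → map (λ f → cons b f) (allDep n (λ k → B (fsuc k)) (λ k → e (fsuc k)))) (e fzero)
  where
  cons : B fzero → ((k : Fin n) → B (fsuc k)) → (k : Fin (suc n)) → B k
  cons b f fzero = b
  cons b f (fsuc k) = f k

allPairs : (m : ℕ) → List (Fin m × Fin m)
allPairs m = concatMap (λ a → map (λ b → (a , b)) (allFin m)) (allFin m)

-- all outcomes (each equally likely: the shifts are independent and uniform)
allShifts : (L : ℕ) → List (Shifts L)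
allShifts L = allDep (suc L) _
  (λ i → allDep (2 * L) (λ _ → Fin (2 ^ toℕ i) × Fin (2 ^ toℕ i)) (λ _ → allPairs (2 ^ toℕ i)))

-- minimum of a list (only used on nonempty lists when L ≥ 1)
minList : List ℕ → ℕ
minList [] = 0
minList (x ∷ xs) = foldr _⊓_ x xs

Cij : ∀ {n} (L : ℕ) → Shifts L → Vec Point n → Vec Point n → Fin (suc L) → Fin (2 * L) → ℕ
Cij L σ S T i j with σ i j
... | (sx , sy) = gridDiff L (toℕ i) (toℕ sx) (toℕ sy) S T

Ci : ∀ {n} (L : ℕ) → Shifts L → Vec Point n → Vec Point n → Fin (suc L) → ℕ
Ci L σ S T i = minList (map (Cij L σ S T i) (allFin (2 * L)))

-- 2Y = Σ_{i=0}^{L} 2^i C_i   (Y itself is half of this)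
twiceY : ∀ {n} (L : ℕ) → Shifts L → Vec Point n → Vec Point n → ℕ
twiceY L σ S T = sum (map (λ i → 2 ^ toℕ i * Ci L σ S T i) (allFin (suc L)))

kOf : ∀ {n} → Vec Point n → Vec Point n → ℕ
kOf S T = distinct S ⊓ distinct T

-- the outcomes in which Y ≤ c·k·d fails, i.e. 2Y > 2·c·k·d
badShifts : ∀ {n} (L c d : ℕ) → Vec Point n → Vec Point n → List (Shifts L)
badShifts L c d S T =
  filter (λ σ → ¬? (twiceY L σ S T ≤? 2 * (c * kOf S T * d))) (allShifts L)

module Submission where

-- Fix a matching π of
-- cost d = EMD(S,T) and let D list the k distinct points of the side with
-- fewer distinct points.  A shift of the level-t grid is good if every point
-- of D is at distance ≥ r_t = 2^t / M, M = 8(k+1), from the cell boundaries.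
--  * Deterministic part: ‖V_G(S) − V_G(T)‖₁ ≤ 2 · #(edges of π cut by G), and
--    a good grid cuts no edge of length ≤ r_t.  So if every level has a good
--    shift, 2Y ≤ Σ_edges Σ_{t : 2^t < M δ} 2 · 2^t ≤ 4 M d ≤ 64 k d.
--  * Probabilistic part: each point of D is unsafe for at most 4 r_t 2^t of
--    the 4^t shift pairs, so a random shift is bad with probability ≤ 1/2.
--    The 2L shifts of a level are independent, so a level has no good shift
--    with probability ≤ 4^-L; a union bound over the L + 1 levels gives
--    failure probability ≤ (L+1)/4^L ≤ 1/(m+1).

open import Defs
open import Data.Nat
open import Data.Nat.Properties
open import Data.Nat.DivMod
open import Data.Nat.Solver using (module +-*-Solver)
open import Algebra.Properties.CommutativeSemigroup +-commutativeSemigroup using (x∙yz≈y∙xz; xy∙z≈xz∙y)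
open import Algebra.Properties.CommutativeSemigroup *-commutativeSemigroup using () renaming (x∙yz≈y∙xz to x∙yz≈y∙xz-*)
open import Data.Nat.ListAction using () renaming (sum to sumᴸ)
open import Data.Nat.ListAction.Properties using (sum-++)
open import Data.List.Properties using (map-++; map-∘)
open import Data.Fin using (Fin; toℕ; fromℕ<) renaming (zero to fzero; suc to fsuc)
open import Data.Fin.Properties using (toℕ-injective; toℕ-fromℕ<; toℕ<n; toℕ-inject₁; toℕ-fromℕ) renaming (suc-injective to fsuc-injective)
open import Data.List.Relation.Unary.All using (All; all?)
import Data.List.Relation.Unary.All as All
open import Data.List.Relation.Unary.Any using (here; there)
open import Data.List.Membership.Propositional using (_∈_)
open import Data.List.Membership.Propositional.Properties using (∈-map⁺; ∈-allFin; ∈-deduplicate⁺)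
open import Data.List using (List; []; _∷_; map; concatMap; length; filter; allFin; tabulate; applyUpTo; _++_; foldr; deduplicate)
open import Data.Vec using (Vec; lookup; toList)
open import Data.Vec.Membership.Propositional.Properties using (∈-lookup; ∈-toList⁺)
open import Data.Product using (_×_; _,_; proj₁; proj₂; ∃-syntax)
open import Data.Sum using (_⊎_; inj₁; inj₂)
open import Data.Fin.Permutation using (Permutation′; _⟨$⟩ʳ_)
open import Relation.Binary.PropositionalEquality
open import Relation.Binary.Definitions using (DecidableEquality)
open import Relation.Nullary using (Dec; yes; no; ¬?; _×-dec_)
open import Data.Empty using (⊥-elim)
open import Relation.Unary using (Pred; Decidable)
open import Algebra.Properties.Semiring.Sum +-*-semiring
  using (sum-syntax; sum-cong-≗; sum-replicate-zero; sum-init-last; ∑-distrib-+; ∑-comm; ∑-permute; *-distribˡ-sum)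

𝟙 : ∀ {p} {P : Set p} → Dec P → ℕ
𝟙 (yes _) = 1
𝟙 (no _) = 0

𝟙-yes : ∀ {p} {P : Set p} (d : Dec P) → P → 𝟙 d ≡ 1
𝟙-yes (yes _) _ = refl
𝟙-yes (no ¬p) p = ⊥-elim (¬p p)

𝟙¬≡0 : ∀ {p} {P : Set p} (d : Dec P) → 𝟙 (¬? d) ≡ 0 → P
𝟙¬≡0 (yes p) _ = p
𝟙¬≡0 (no _) ()

Σl : ∀ {a} {A : Set a} → List A → (A → ℕ) → ℕ
Σl xs f = sumᴸ (map f xs)

Σl-cong : ∀ {a} {A : Set a} (xs : List A) {f g : A → ℕ} → (∀ x → f x ≡ g x) → Σl xs f ≡ Σl xs g
Σl-cong [] e = refl
Σl-cong (x ∷ xs) e = cong₂ _+_ (e x) (Σl-cong xs e)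

Σl-mono : ∀ {a} {A : Set a} (xs : List A) {f g : A → ℕ} → (∀ x → f x ≤ g x) → Σl xs f ≤ Σl xs g
Σl-mono [] e = z≤n
Σl-mono (x ∷ xs) e = +-mono-≤ (e x) (Σl-mono xs e)

Σl-* : ∀ {a} {A : Set a} (xs : List A) (c : ℕ) (f : A → ℕ) → Σl xs (λ x → c * f x) ≡ c * Σl xs f
Σl-* [] c f = sym (*-zeroʳ c)
Σl-* (x ∷ xs) c f = trans (cong (c * f x +_) (Σl-* xs c f)) (sym (*-distribˡ-+ c (f x) (Σl xs f)))

Σl-const : ∀ {a} {A : Set a} (xs : List A) (c : ℕ) → Σl xs (λ _ → c) ≡ length xs * c
Σl-const [] c = refl
Σl-const (x ∷ xs) c = cong (c +_) (Σl-const xs c)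

Σl-map : ∀ {a b} {A : Set a} {B : Set b} (xs : List A) (g : A → B) (f : B → ℕ) →
  Σl (map g xs) f ≡ Σl xs (λ x → f (g x))
Σl-map xs g f = cong sumᴸ (sym (map-∘ {g = f} {f = g} xs))

Σl-++ : ∀ {a} {A : Set a} (xs ys : List A) (f : A → ℕ) → Σl (xs ++ ys) f ≡ Σl xs f + Σl ys f
Σl-++ xs ys f = trans (cong sumᴸ (map-++ f xs ys)) (sum-++ (map f xs) (map f ys))

Σl-concatMap : ∀ {a b} {A : Set a} {B : Set b} (h : A → List B) (xs : List A) (f : B → ℕ) →
  Σl (concatMap h xs) f ≡ Σl xs (λ x → Σl (h x) f)
Σl-concatMap h [] f = refl
Σl-concatMap h (x ∷ xs) f = trans (Σl-++ (h x) (concatMap h xs) f) (cong (Σl (h x) f +_) (Σl-concatMap h xs f))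

length-filter-𝟙 : ∀ {a p} {A : Set a} {P : Pred A p} (P? : Decidable P) (xs : List A) →
  length (filter P? xs) ≡ Σl xs (λ x → 𝟙 (P? x))
length-filter-𝟙 P? [] = refl
length-filter-𝟙 P? (x ∷ xs) with P? x
... | yes _ = cong suc (length-filter-𝟙 P? xs)
... | no _ = length-filter-𝟙 P? xs

length-Σl : ∀ {a} {A : Set a} (xs : List A) → length xs ≡ Σl xs (λ _ → 1)
length-Σl xs = trans (sym (*-identityʳ (length xs))) (sym (Σl-const xs 1))

𝟙-¬all≤ : ∀ {a p} {A : Set a} {P : Pred A p} (P? : Decidable P) (xs : List A) →
  𝟙 (¬? (all? P? xs)) ≤ Σl xs (λ x → 𝟙 (¬? (P? x)))
𝟙-¬all≤ P? [] = z≤n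
𝟙-¬all≤ P? (x ∷ xs) with P? x
... | no _ = s≤s z≤n
... | yes _ with all? P? xs | 𝟙-¬all≤ P? xs
...   | yes _ | _ = z≤n
...   | no _ | ih = ih

∑-mono : ∀ n {f g : Fin n → ℕ} → (∀ k → f k ≤ g k) → ∑[ k < n ] f k ≤ ∑[ k < n ] g k
∑-mono zero e = z≤n
∑-mono (suc n) e = +-mono-≤ (e fzero) (∑-mono n (λ k → e (fsuc k)))

∑-const : ∀ n c → ∑[ k < n ] c ≡ n * c
∑-const zero c = refl
∑-const (suc n) c = cong (c +_) (∑-const n c)

term≤∑ : ∀ n (f : Fin n → ℕ) (k : Fin n) → f k ≤ ∑[ i < n ] f i
term≤∑ (suc n) f fzero = m≤m+n _ _
term≤∑ (suc n) f (fsuc k) = ≤-trans (term≤∑ n (λ i → f (fsuc i)) k) (m≤n+m _ _)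

∑-∣-∣ : ∀ n (f g : Fin n → ℕ) → ∣ ∑[ k < n ] f k - ∑[ k < n ] g k ∣ ≤ ∑[ k < n ] ∣ f k - g k ∣
∑-∣-∣ zero f g = z≤n
∑-∣-∣ (suc n) f g = ≤-trans (∣a+b-c+d∣ (f fzero) _ (g fzero) _)
  (+-monoʳ-≤ _ (∑-∣-∣ n (λ k → f (fsuc k)) (λ k → g (fsuc k))))
  where
  ∣a+b-c+d∣ : ∀ a b c d → ∣ a + b - c + d ∣ ≤ ∣ a - c ∣ + ∣ b - d ∣
  ∣a+b-c+d∣ a b c d = ≤-trans (∣-∣-triangle (a + b) (c + b) (c + d))
    (+-mono-≤ (≤-reflexive (trans (cong₂ ∣_-_∣ (+-comm a b) (+-comm c b)) (∣m+n-m+o∣≡∣n-o∣ b a c)))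
              (≤-reflexive (∣m+n-m+o∣≡∣n-o∣ c b d)))

Σl-∑-comm : ∀ {a} {A : Set a} (xs : List A) n (f : A → Fin n → ℕ) →
  Σl xs (λ x → ∑[ k < n ] f x k) ≡ ∑[ k < n ] Σl xs (λ x → f x k)
Σl-∑-comm [] n f = sym (sum-replicate-zero n)
Σl-∑-comm (x ∷ xs) n f = trans (cong (∑[ k < n ] f x k +_) (Σl-∑-comm xs n f))
  (sym (∑-distrib-+ (f x) (λ k → Σl xs (λ y → f y k))))

Σl-tabulate : ∀ {a} {A : Set a} n (g : Fin n → A) (f : A → ℕ) → Σl (tabulate g) f ≡ ∑[ k < n ] f (g k)
Σl-tabulate zero g f = refl
Σl-tabulate (suc n) g f = cong (f (g fzero) +_) (Σl-tabulate n (λ k → g (fsuc k)) f)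

Σl-allFin : ∀ n (f : Fin n → ℕ) → Σl (allFin n) f ≡ ∑[ k < n ] f k
Σl-allFin n f = Σl-tabulate n (λ k → k) f

Σl-applyUpTo : ∀ n (g f : ℕ → ℕ) → Σl (applyUpTo g n) f ≡ ∑[ k < n ] f (g (toℕ k))
Σl-applyUpTo zero g f = refl
Σl-applyUpTo (suc n) g f = cong (f (g 0) +_) (Σl-applyUpTo n (λ x → g (suc x)) f)

Σl-toList : ∀ {a} {A : Set a} n (S : Vec A n) (f : A → ℕ) → Σl (toList S) f ≡ ∑[ k < n ] f (lookup S k)
Σl-toList zero Vec.[] f = refl
Σl-toList (suc n) (x Vec.∷ S) f = cong (f x +_) (Σl-toList n S f)

hits≤1 : ∀ {A : Set} (_≟A_ : DecidableEquality A) M (g : Fin M → A) →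
  (∀ a b → g a ≡ g b → a ≡ b) → ∀ u → ∑[ k < M ] 𝟙 (u ≟A g k) ≤ 1
hits≤1 _≟A_ zero g inj u = z≤n
hits≤1 _≟A_ (suc M) g inj u with u ≟A g fzero
... | yes u≡g0 = ≤-reflexive (cong suc (trans (sum-cong-≗ missed) (sum-replicate-zero M)))
  where
  missed : ∀ k → 𝟙 (u ≟A g (fsuc k)) ≡ 0
  missed k with u ≟A g (fsuc k)
  ... | no _ = refl
  ... | yes u≡gk with inj fzero (fsuc k) (trans (sym u≡g0) u≡gk)
  ...   | ()
... | no _ = hits≤1 _≟A_ M (λ k → g (fsuc k)) (λ a b e → fsuc-injective (inj _ _ e)) u

hits-below : ∀ M (g : Fin M → ℕ) → (∀ a b → g a ≡ g b → a ≡ b) →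
  ∀ r → ∑[ k < M ] 𝟙 (g k <? r) ≤ r
hits-below M g inj r = begin
  ∑[ k < M ] 𝟙 (g k <? r)                    ≤⟨ ∑-mono M below ⟩
  ∑[ k < M ] ∑[ t < r ] 𝟙 (toℕ t ≟ g k)     ≡⟨ ∑-comm {M} {r} (λ k t → 𝟙 (toℕ t ≟ g k)) ⟩
  ∑[ t < r ] ∑[ k < M ] 𝟙 (toℕ t ≟ g k)     ≤⟨ ∑-mono r (λ t → hits≤1 _≟_ M g inj (toℕ t)) ⟩
  ∑[ t < r ] 1                               ≡⟨ trans (∑-const r 1) (*-identityʳ r) ⟩
  r                                          ∎
  where
  open ≤-Reasoning
  below : ∀ k → 𝟙 (g k <? r) ≤ ∑[ t < r ] 𝟙 (toℕ t ≟ g k)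
  below k with g k <? r
  ... | no _ = z≤n
  ... | yes gk<r = ≤-trans (≤-reflexive (sym (𝟙-yes (toℕ t ≟ g k) (toℕ-fromℕ< gk<r)))) (term≤∑ r _ t)
    where t = fromℕ< gk<r

separates : (i sx sy : ℕ) → Point → Point → ℕ
separates i sx sy p q = 𝟙 (¬? (cellOf i sx sy p ≟P cellOf i sx sy q))

cellCount-∑ : ∀ {n} i sx sy (S : Vec Point n) c →
  cellCount i sx sy S c ≡ ∑[ a < n ] 𝟙 (cellOf i sx sy (lookup S a) ≟P c)
cellCount-∑ {n} i sx sy S c = trans (length-filter-𝟙 _ (toList S)) (Σl-toList n S _)

𝟙-pair≤ : ∀ x y u v → 𝟙 ((x , y) ≟P (u , v)) ≤ 𝟙 (x ≟ u) * 𝟙 (y ≟ v)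
𝟙-pair≤ x y u v with (x , y) ≟P (u , v)
... | no _ = z≤n
... | yes refl with x ≟ x | y ≟ y
...   | yes _ | yes _ = ≤-refl
...   | no x≢x | _ = ⊥-elim (x≢x refl)
...   | yes _ | no y≢y = ⊥-elim (y≢y refl)

cell-hits≤1 : ∀ M (p : Point) → ∑[ u < M ] ∑[ v < M ] 𝟙 (p ≟P (toℕ u , toℕ v)) ≤ 1
cell-hits≤1 M (x , y) = begin
  ∑[ u < M ] ∑[ v < M ] 𝟙 ((x , y) ≟P (toℕ u , toℕ v))
    ≤⟨ ∑-mono M (λ u → ∑-mono M (λ v → 𝟙-pair≤ x y (toℕ u) (toℕ v))) ⟩
  ∑[ u < M ] ∑[ v < M ] (𝟙 (x ≟ toℕ u) * 𝟙 (y ≟ toℕ v))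
    ≡⟨ sum-cong-≗ {M} (λ u → sym (*-distribˡ-sum {M} (𝟙 (x ≟ toℕ u)) (λ v → 𝟙 (y ≟ toℕ v)))) ⟩
  ∑[ u < M ] (𝟙 (x ≟ toℕ u) * ∑[ v < M ] 𝟙 (y ≟ toℕ v))
    ≤⟨ ∑-mono M (λ u → *-monoʳ-≤ (𝟙 (x ≟ toℕ u)) (hits≤1 _≟_ M toℕ toℕ-inj y)) ⟩
  ∑[ u < M ] (𝟙 (x ≟ toℕ u) * 1)
    ≡⟨ sum-cong-≗ {M} (λ u → *-identityʳ (𝟙 (x ≟ toℕ u))) ⟩
  ∑[ u < M ] 𝟙 (x ≟ toℕ u)
    ≤⟨ hits≤1 _≟_ M toℕ toℕ-inj x ⟩
  1 ∎
  where
  open ≤-Reasoning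
  toℕ-inj : ∀ a b → toℕ a ≡ toℕ b → a ≡ b
  toℕ-inj a b = toℕ-injective

cell-indicator-diff : ∀ M (p q : Point) →
  ∑[ u < M ] ∑[ v < M ] ∣ 𝟙 (p ≟P (toℕ u , toℕ v)) - 𝟙 (q ≟P (toℕ u , toℕ v)) ∣ ≤ 2 * 𝟙 (¬? (p ≟P q))
cell-indicator-diff M p q with p ≟P q
... | yes refl = ≤-reflexive (trans
        (sum-cong-≗ {M} (λ u → trans (sum-cong-≗ {M} (λ v → ∣n-n∣≡0 (𝟙 (p ≟P (toℕ u , toℕ v))))) (sum-replicate-zero M)))
        (sum-replicate-zero M))
... | no _ = begin
  ∑[ u < M ] ∑[ v < M ] ∣ P u v - Q u v ∣
    ≤⟨ ∑-mono M (λ u → ∑-mono M (λ v → ≤-trans (∣m-n∣≤m⊔n (P u v) (Q u v)) (m⊔n≤m+n (P u v) (Q u v)))) ⟩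
  ∑[ u < M ] ∑[ v < M ] (P u v + Q u v)
    ≡⟨ trans (sum-cong-≗ {M} (λ u → ∑-distrib-+ {M} (P u) (Q u))) (∑-distrib-+ {M} (λ u → ∑[ v < M ] P u v) _) ⟩
  ∑[ u < M ] ∑[ v < M ] P u v + ∑[ u < M ] ∑[ v < M ] Q u v
    ≤⟨ +-mono-≤ (cell-hits≤1 M p) (cell-hits≤1 M q) ⟩
  2 ∎
  where
  open ≤-Reasoning
  P Q : Fin M → Fin M → ℕ
  P u v = 𝟙 (p ≟P (toℕ u , toℕ v))
  Q u v = 𝟙 (q ≟P (toℕ u , toℕ v))

gridDiff≤separated : ∀ L i sx sy n (S T : Vec Point n) (π : Permutation′ n) →
  gridDiff L i sx sy S T ≤ 2 * ∑[ a < n ] separates i sx sy (lookup S a) (lookup T (π ⟨$⟩ʳ a))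
gridDiff≤separated L i sx sy n S T π = begin
  gridDiff L i sx sy S T
    ≡⟨ trans (Σl-applyUpTo M (λ x → x) _) (sum-cong-≗ {M} (λ u → Σl-applyUpTo M (λ x → x) _)) ⟩
  ∑[ u < M ] ∑[ v < M ] ∣ cellCount i sx sy S (c u v) - cellCount i sx sy T (c u v) ∣
    ≡⟨ sum-cong-≗ {M} (λ u → sum-cong-≗ {M} (λ v → cong₂ ∣_-_∣ (cellCount-∑ i sx sy S (c u v))
         (trans (cellCount-∑ i sx sy T (c u v)) (∑-permute (λ b → 𝟙 (cellOf i sx sy (lookup T b) ≟P c u v)) π)))) ⟩
  ∑[ u < M ] ∑[ v < M ] ∣ ∑[ a < n ] 𝟙 (cS a ≟P c u v) - ∑[ a < n ] 𝟙 (cT a ≟P c u v) ∣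
    ≤⟨ ∑-mono M (λ u → ∑-mono M (λ v → ∑-∣-∣ n _ _)) ⟩
  ∑[ u < M ] ∑[ v < M ] ∑[ a < n ] ∣ 𝟙 (cS a ≟P c u v) - 𝟙 (cT a ≟P c u v) ∣
    ≡⟨ trans (sum-cong-≗ {M} (λ u → ∑-comm {M} {n} _)) (∑-comm {M} {n} _) ⟩
  ∑[ a < n ] ∑[ u < M ] ∑[ v < M ] ∣ 𝟙 (cS a ≟P c u v) - 𝟙 (cT a ≟P c u v) ∣
    ≤⟨ ∑-mono n (λ a → cell-indicator-diff M (cS a) (cT a)) ⟩
  ∑[ a < n ] (2 * separates i sx sy (lookup S a) (lookup T (π ⟨$⟩ʳ a)))
    ≡⟨ sym (*-distribˡ-sum {n} 2 _) ⟩
  2 * ∑[ a < n ] separates i sx sy (lookup S a) (lookup T (π ⟨$⟩ʳ a)) ∎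
  where
  open ≤-Reasoning
  M = 2 ^ (L ∸ i) + 2
  c : Fin M → Fin M → Point
  c u v = (toℕ u , toℕ v)
  cS cT : Fin n → Point
  cS a = cellOf i sx sy (lookup S a)
  cT a = cellOf i sx sy (lookup T (π ⟨$⟩ʳ a))

/-between : ∀ {N} .{{_ : NonZero N}} q z → q * N ≤ z → z < suc q * N → z / N ≡ q
/-between {N} q z qN≤z z<[1+q]N = ≤-antisym (s≤s⁻¹ (m<n*o⇒m/o<n z<[1+q]N))
  (subst (_≤ z / N) (m*n/n≡m q N) (/-monoˡ-≤ N qN≤z))

same-block : ∀ r N .{{_ : NonZero N}} z z' → r ≤ z % N → z % N + r < N → ∣ z - z' ∣ ≤ r →
  z' / N ≡ z / N
same-block r N z z' r≤p p+r<N ∣z-z'∣≤r = /-between (z / N) z' lower upper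
  where
  open ≤-Reasoning
  p = z % N
  qN = z / N * N
  z≡p+qN : z ≡ p + qN
  z≡p+qN = m≡m%n+[m/n]*n z N
  lower : qN ≤ z'
  lower = +-cancelˡ-≤ r qN z' (begin
    r + qN             ≤⟨ +-monoˡ-≤ qN r≤p ⟩
    p + qN             ≡⟨ z≡p+qN ⟨
    z                  ≤⟨ m≤n+∣m-n∣ z z' ⟩
    z' + ∣ z - z' ∣    ≤⟨ +-monoʳ-≤ z' ∣z-z'∣≤r ⟩
    z' + r             ≡⟨ +-comm z' r ⟩
    r + z'             ∎)
  upper : z' < suc (z / N) * N
  upper = begin-strict
    z'                 ≤⟨ m≤n+∣m-n∣ z' z ⟩
    z + ∣ z' - z ∣     ≤⟨ +-monoʳ-≤ z (subst (_≤ r) (∣-∣-comm z z') ∣z-z'∣≤r) ⟩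
    z + r              ≡⟨ cong (_+ r) z≡p+qN ⟩
    p + qN + r         ≡⟨ xy∙z≈xz∙y p qN r ⟩
    p + r + qN         <⟨ +-monoˡ-< qN p+r<N ⟩
    N + qN             ∎

-- In the level-i grid with shift s the integer x has cell index
-- offset i s x / 2^i (this is cellIndex) and position offset i s x % 2^i
-- inside its cell.
offset : (i s x : ℕ) → ℕ
offset i s x = x + 2 ^ i ∸ suc s

position : (i s x : ℕ) → ℕ
position i s x = _%_ (offset i s x) (2 ^ i) {{m^n≢0 2 i}}

position<2^i : ∀ i s x → position i s x < 2 ^ i
position<2^i i s x = m%n<n (offset i s x) (2 ^ i) {{m^n≢0 2 i}}

Safe : (r i s x : ℕ) → Set
Safe r i s x = r ≤ position i s x × position i s x + r < 2 ^ i

safe? : ∀ r i s x → Dec (Safe r i s x)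
safe? r i s x = (r ≤? position i s x) ×-dec (position i s x + r <? 2 ^ i)

offset-dist : ∀ i s x x' → s < 2 ^ i → ∣ offset i s x - offset i s x' ∣ ≡ ∣ x - x' ∣
offset-dist i s x x' s<N = begin
  ∣ offset i s x - offset i s x' ∣  ≡⟨ cong₂ ∣_-_∣ (+-∸-assoc x s<N) (+-∸-assoc x' s<N) ⟩
  ∣ x + t - x' + t ∣                ≡⟨ cong₂ ∣_-_∣ (+-comm x t) (+-comm x' t) ⟩
  ∣ t + x - t + x' ∣                ≡⟨ ∣m+n-m+o∣≡∣n-o∣ t x x' ⟩
  ∣ x - x' ∣                        ∎
  where
  open ≡-Reasoning
  t = 2 ^ i ∸ suc s

same-cell-index : ∀ r i s x x' → s < 2 ^ i → Safe r i s x → ∣ x - x' ∣ ≤ r →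
  cellIndex i s x' ≡ cellIndex i s x
same-cell-index r i s x x' s<N (r≤p , p+r<N) ∣x-x'∣≤r =
  same-block r (2 ^ i) {{m^n≢0 2 i}} (offset i s x) (offset i s x') r≤p p+r<N
    (subst (_≤ r) (sym (offset-dist i s x x' s<N)) ∣x-x'∣≤r)

-- For fixed x, s ↦ position i s x is an involution of {0, …, 2^i − 1}:
-- the position of x determines the shift.
position-involutive : ∀ i s x → s < 2 ^ i → position i (position i s x) x ≡ s
position-involutive i s x s<N = begin
  (x + N ∸ suc p) % N            ≡⟨ cong (λ w → (w ∸ suc p) % N) x+N≡ ⟩
  (suc s + (p + qN) ∸ suc p) % N ≡⟨ cong (λ w → (w ∸ p) % N) (x∙yz≈y∙xz s p qN) ⟩
  (p + (s + qN) ∸ p) % N         ≡⟨ cong (_% N) (m+n∸m≡n p (s + qN)) ⟩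
  (s + qN) % N                   ≡⟨ [m+kn]%n≡m%n s (offset i s x / N) N ⟩
  s % N                          ≡⟨ m<n⇒m%n≡m s<N ⟩
  s                              ∎
  where
  open ≡-Reasoning
  N = 2 ^ i
  instance
    N-nonZero : NonZero N
    N-nonZero = m^n≢0 2 i
  p = offset i s x % N
  qN = offset i s x / N * N
  x+N≡ : x + N ≡ suc s + (p + qN)
  x+N≡ = trans (sym (m+[n∸m]≡n (≤-trans s<N (m≤n+m N x)))) (cong (suc s +_) (m≡m%n+[m/n]*n (offset i s x) N))

position-injective : ∀ i x (s s' : Fin (2 ^ i)) → position i (toℕ s) x ≡ position i (toℕ s') x → s ≡ s'
position-injective i x s s' e = toℕ-injective (begin
  toℕ s                             ≡⟨ position-involutive i (toℕ s) x (toℕ<n s) ⟨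
  position i (position i (toℕ s) x) x   ≡⟨ cong (λ p → position i p x) e ⟩
  position i (position i (toℕ s') x) x  ≡⟨ position-involutive i (toℕ s') x (toℕ<n s') ⟩
  toℕ s'                            ∎)
  where open ≡-Reasoning

mirror : ℕ → ℕ → ℕ
mirror N p = N ∸ suc p

suc-mirror : ∀ {N p} → p < N → suc (mirror N p) ≡ N ∸ p
suc-mirror p<N = sym (+-∸-assoc 1 p<N)

mirror-involutive : ∀ {N p} → p < N → mirror N (mirror N p) ≡ p
mirror-involutive {N} {p} p<N = trans (cong (N ∸_) (suc-mirror p<N)) (m∸[m∸n]≡n (<⇒≤ p<N))

unsafe⇒near-boundary : ∀ r i s x → 𝟙 (¬? (safe? r i s x)) ≤
  𝟙 (position i s x <? r) + 𝟙 (mirror (2 ^ i) (position i s x) <? r)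
unsafe⇒near-boundary r i s x with safe? r i s x
... | yes _ = z≤n
... | no unsafe with position i s x <? r
...   | yes _ = s≤s z≤n
...   | no p≮r = ≤-reflexive (sym (𝟙-yes (mirror N p <? r) near-right))
  where
  N = 2 ^ i
  p = position i s x
  N≤p+r : N ≤ p + r
  N≤p+r = ≮⇒≥ (λ p+r<N → unsafe (≮⇒≥ p≮r , p+r<N))
  near-right : mirror N p < r
  near-right = subst (_≤ r) (sym (suc-mirror (position<2^i i s x))) (m≤n+o⇒m∸n≤o N p N≤p+r)

unsafe-shifts : ∀ r i x → ∑[ s < 2 ^ i ] 𝟙 (¬? (safe? r i (toℕ s) x)) ≤ r + r
unsafe-shifts r i x = begin
  ∑[ s < N ] 𝟙 (¬? (safe? r i (toℕ s) x))
    ≤⟨ ∑-mono N (λ s → unsafe⇒near-boundary r i (toℕ s) x) ⟩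
  ∑[ s < N ] (𝟙 (pos s <? r) + 𝟙 (mirror N (pos s) <? r))
    ≡⟨ ∑-distrib-+ {N} (λ s → 𝟙 (pos s <? r)) (λ s → 𝟙 (mirror N (pos s) <? r)) ⟩
  ∑[ s < N ] 𝟙 (pos s <? r) + ∑[ s < N ] 𝟙 (mirror N (pos s) <? r)
    ≤⟨ +-mono-≤ (hits-below N pos pos-inj r) (hits-below N (λ s → mirror N (pos s)) mirror-pos-inj r) ⟩
  r + r ∎
  where
  open ≤-Reasoning
  N = 2 ^ i
  pos : Fin N → ℕ
  pos s = position i (toℕ s) x
  pos-inj : ∀ a b → pos a ≡ pos b → a ≡ b
  pos-inj = position-injective i x
  mirror-pos-inj : ∀ a b → mirror N (pos a) ≡ mirror N (pos b) → a ≡ b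
  mirror-pos-inj a b e = pos-inj a b (begin-equality
    pos a                       ≡⟨ mirror-involutive (position<2^i i (toℕ a) x) ⟨
    mirror N (mirror N (pos a)) ≡⟨ cong (mirror N) e ⟩
    mirror N (mirror N (pos b)) ≡⟨ mirror-involutive (position<2^i i (toℕ b) x) ⟩
    pos b                       ∎)

SafePoint : (r i sx sy : ℕ) → Point → Set
SafePoint r i sx sy (x , y) = Safe r i sx x × Safe r i sy y

safePoint? : ∀ r i sx sy p → Dec (SafePoint r i sx sy p)
safePoint? r i sx sy (x , y) = safe? r i sx x ×-dec safe? r i sy y

same-cell : ∀ r i sx sy p q → sx < 2 ^ i → sy < 2 ^ i → SafePoint r i sx sy p → dist₁ p q ≤ r →
  cellOf i sx sy q ≡ cellOf i sx sy p
same-cell r i sx sy (x , y) (x' , y') sx<N sy<N (safe-x , safe-y) d≤r =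
  cong₂ _,_ (same-cell-index r i sx x x' sx<N safe-x (≤-trans (m≤m+n _ _) d≤r))
            (same-cell-index r i sy y y' sy<N safe-y (≤-trans (m≤n+m _ _) d≤r))

unsafe-point : ∀ r i sx sy x y →
  𝟙 (¬? (safePoint? r i sx sy (x , y))) ≤ 𝟙 (¬? (safe? r i sx x)) + 𝟙 (¬? (safe? r i sy y))
unsafe-point r i sx sy x y with safe? r i sx x | safe? r i sy y
... | yes _ | yes _ = z≤n
... | yes _ | no _ = ≤-refl
... | no _ | _ = s≤s z≤n

Σl-allPairs : ∀ N (f : Fin N × Fin N → ℕ) → Σl (allPairs N) f ≡ ∑[ a < N ] ∑[ b < N ] f (a , b)
Σl-allPairs N f = begin
  Σl (allPairs N) f                                  ≡⟨ Σl-concatMap _ (allFin N) f ⟩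
  Σl (allFin N) (λ a → Σl (map (a ,_) (allFin N)) f) ≡⟨ Σl-cong (allFin N) (λ a → Σl-map (allFin N) (a ,_) f) ⟩
  Σl (allFin N) (λ a → Σl (allFin N) (λ b → f (a , b))) ≡⟨ Σl-allFin N _ ⟩
  ∑[ a < N ] Σl (allFin N) (λ b → f (a , b))          ≡⟨ sum-cong-≗ {N} (λ a → Σl-allFin N _) ⟩
  ∑[ a < N ] ∑[ b < N ] f (a , b)                     ∎
  where open ≡-Reasoning

unsafe-shift-pairs : ∀ r i x y →
  ∑[ a < 2 ^ i ] ∑[ b < 2 ^ i ] 𝟙 (¬? (safePoint? r i (toℕ a) (toℕ b) (x , y))) ≤ 2 ^ i * (r + r) + 2 ^ i * (r + r)
unsafe-shift-pairs r i x y = begin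
  ∑[ a < N ] ∑[ b < N ] 𝟙 (¬? (safePoint? r i (toℕ a) (toℕ b) (x , y)))
    ≤⟨ ∑-mono N (λ a → ∑-mono N (λ b → unsafe-point r i (toℕ a) (toℕ b) x y)) ⟩
  ∑[ a < N ] ∑[ b < N ] (U a + V b)
    ≡⟨ sum-cong-≗ {N} (λ a → trans (∑-distrib-+ {N} (λ _ → U a) V) (cong (_+ ∑[ b < N ] V b) (∑-const N (U a)))) ⟩
  ∑[ a < N ] (N * U a + ∑[ b < N ] V b)
    ≡⟨ trans (∑-distrib-+ {N} (λ a → N * U a) (λ _ → ∑[ b < N ] V b))
             (cong₂ _+_ (sym (*-distribˡ-sum {N} N U)) (∑-const N _)) ⟩
  N * ∑[ a < N ] U a + N * ∑[ b < N ] V b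
    ≤⟨ +-mono-≤ (*-monoʳ-≤ N (unsafe-shifts r i x)) (*-monoʳ-≤ N (unsafe-shifts r i y)) ⟩
  N * (r + r) + N * (r + r) ∎
  where
  open ≤-Reasoning
  N = 2 ^ i
  U V : Fin N → ℕ
  U a = 𝟙 (¬? (safe? r i (toℕ a) x))
  V b = 𝟙 (¬? (safe? r i (toℕ b) y))

-- f has mean at most 1/c on xs, xs being read as a uniform sample space.
Sparse : ∀ {a} {A : Set a} → ℕ → List A → (A → ℕ) → Set
Sparse c xs f = c * Σl xs f ≤ length xs

GoodShift : (r i : ℕ) → List Point → Fin (2 ^ i) × Fin (2 ^ i) → Set
GoodShift r i D (a , b) = All (SafePoint r i (toℕ a) (toℕ b)) D

goodShift? : ∀ r i D σ → Dec (GoodShift r i D σ)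
goodShift? r i D (a , b) = all? (safePoint? r i (toℕ a) (toℕ b)) D

badShift : (r i : ℕ) → List Point → Fin (2 ^ i) × Fin (2 ^ i) → ℕ
badShift r i D σ = 𝟙 (¬? (goodShift? r i D σ))

length-allPairs : ∀ N → length (allPairs N) ≡ N * N
length-allPairs N = begin
  length (allPairs N)         ≡⟨ length-Σl (allPairs N) ⟩
  Σl (allPairs N) (λ _ → 1)   ≡⟨ Σl-allPairs N (λ _ → 1) ⟩
  ∑[ a < N ] ∑[ b < N ] 1     ≡⟨ trans (sum-cong-≗ {N} (λ a → ∑-const N 1)) (∑-const N (N * 1)) ⟩
  N * (N * 1)                 ≡⟨ cong (N *_) (*-identityʳ N) ⟩
  N * N                       ∎
  where open ≡-Reasoning

bad-shifts-sparse : ∀ r i D → 8 * length D * r ≤ 2 ^ i → Sparse 2 (allPairs (2 ^ i)) (badShift r i D)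
bad-shifts-sparse r i D 8kr≤N = begin
  2 * Σl (allPairs N) (badShift r i D)
    ≤⟨ *-monoʳ-≤ 2 (Σl-mono (allPairs N) (λ { (a , b) → 𝟙-¬all≤ (safePoint? r i (toℕ a) (toℕ b)) D })) ⟩
  2 * Σl (allPairs N) (λ { (a , b) → Σl D (unsafe a b) })
    ≡⟨ cong (2 *_) (Σl-allPairs N _) ⟩
  2 * ∑[ a < N ] ∑[ b < N ] Σl D (unsafe a b)
    ≡⟨ cong (2 *_) (sym (trans (Σl-∑-comm D N (λ p a → ∑[ b < N ] unsafe a b p))
                                (sum-cong-≗ {N} (λ a → Σl-∑-comm D N (λ p b → unsafe a b p))))) ⟩
  2 * Σl D (λ p → ∑[ a < N ] ∑[ b < N ] unsafe a b p)
    ≤⟨ *-monoʳ-≤ 2 (Σl-mono D (λ { (x , y) → unsafe-shift-pairs r i x y })) ⟩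
  2 * Σl D (λ _ → N * (r + r) + N * (r + r))
    ≡⟨ cong (2 *_) (Σl-const D _) ⟩
  2 * (length D * (N * (r + r) + N * (r + r)))
    ≡⟨ rearrange (length D) N r ⟩
  8 * length D * r * N
    ≤⟨ *-monoˡ-≤ N 8kr≤N ⟩
  N * N
    ≡⟨ length-allPairs N ⟨
  length (allPairs N) ∎
  where
  open ≤-Reasoning
  N = 2 ^ i
  unsafe : Fin N → Fin N → Point → ℕ
  unsafe a b p = 𝟙 (¬? (safePoint? r i (toℕ a) (toℕ b) p))
  rearrange : ∀ k N r → 2 * (k * (N * (r + r) + N * (r + r))) ≡ 8 * k * r * N
  rearrange = solve 3 (λ k N r → con 2 :* (k :* (N :* (r :+ r) :+ N :* (r :+ r))) := con 8 :* k :* r :* N) refl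
    where open +-*-Solver

Σl-allDep-split : ∀ n (B : Fin (suc n) → Set) (e : (k : Fin (suc n)) → List (B k))
  (G : B fzero → ((k : Fin n) → B (fsuc k)) → ℕ) →
  Σl (allDep (suc n) B e) (λ f → G (f fzero) (λ k → f (fsuc k)))
    ≡ Σl (e fzero) (λ b → Σl (allDep n (λ k → B (fsuc k)) (λ k → e (fsuc k))) (G b))
Σl-allDep-split n B e G = trans (Σl-concatMap _ (e fzero) F) (Σl-cong (e fzero) (λ b → Σl-map R _ F))
  where
  R = allDep n (λ k → B (fsuc k)) (λ k → e (fsuc k))
  F : ((k : Fin (suc n)) → B k) → ℕ
  F f = G (f fzero) (λ k → f (fsuc k))

length-allDep : ∀ n (B : Fin (suc n) → Set) (e : (k : Fin (suc n)) → List (B k)) →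
  length (allDep (suc n) B e) ≡ length (e fzero) * length (allDep n (λ k → B (fsuc k)) (λ k → e (fsuc k)))
length-allDep n B e = begin
  length (allDep (suc n) B e)               ≡⟨ length-Σl (allDep (suc n) B e) ⟩
  Σl (allDep (suc n) B e) (λ _ → 1)         ≡⟨ Σl-allDep-split n B e (λ _ _ → 1) ⟩
  Σl (e fzero) (λ _ → Σl R (λ _ → 1))       ≡⟨ Σl-const (e fzero) _ ⟩
  length (e fzero) * Σl R (λ _ → 1)         ≡⟨ cong (length (e fzero) *_) (length-Σl R) ⟨
  length (e fzero) * length R               ∎
  where
  open ≡-Reasoning
  R = allDep n (λ k → B (fsuc k)) (λ k → e (fsuc k))

-- Sparsity of a weight on one coordinate of a product space is
-- inherited by the whole product (the coordinates are independent).
sparse-coordinate : ∀ n (B : Fin n → Set) (e : (k : Fin n) → List (B k)) (i : Fin n) (h : B i → ℕ) c →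
  Sparse c (e i) h → Sparse c (allDep n B e) (λ f → h (f i))
sparse-coordinate (suc n) B e fzero h c sparse = begin
  c * Σl (allDep (suc n) B e) (λ f → h (f fzero))
    ≡⟨ cong (c *_) (trans (Σl-allDep-split n B e (λ b _ → h b)) (Σl-cong (e fzero) (λ b → Σl-const R (h b)))) ⟩
  c * Σl (e fzero) (λ b → length R * h b)
    ≡⟨ cong (c *_) (Σl-* (e fzero) (length R) h) ⟩
  c * (length R * Σl (e fzero) h)
    ≡⟨ x∙yz≈y∙xz-* c (length R) _ ⟩
  length R * (c * Σl (e fzero) h)
    ≤⟨ *-monoʳ-≤ (length R) sparse ⟩
  length R * length (e fzero)
    ≡⟨ trans (*-comm (length R) _) (sym (length-allDep n B e)) ⟩
  length (allDep (suc n) B e) ∎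
  where
  open ≤-Reasoning
  R = allDep n (λ k → B (fsuc k)) (λ k → e (fsuc k))
sparse-coordinate (suc n) B e (fsuc i) h c sparse = begin
  c * Σl (allDep (suc n) B e) (λ f → h (f (fsuc i)))
    ≡⟨ cong (c *_) (Σl-allDep-split n B e (λ _ g → h (g i))) ⟩
  c * Σl (e fzero) (λ _ → Σl R (λ g → h (g i)))
    ≡⟨ Σl-* (e fzero) c _ ⟨
  Σl (e fzero) (λ _ → c * Σl R (λ g → h (g i)))
    ≤⟨ Σl-mono (e fzero) (λ _ → sparse-coordinate n (λ k → B (fsuc k)) (λ k → e (fsuc k)) i h c sparse) ⟩
  Σl (e fzero) (λ _ → length R)
    ≡⟨ trans (Σl-const (e fzero) (length R)) (sym (length-allDep n B e)) ⟩
  length (allDep (suc n) B e) ∎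
  where
  open ≤-Reasoning
  R = allDep n (λ k → B (fsuc k)) (λ k → e (fsuc k))

∏ : ∀ n → (Fin n → ℕ) → ℕ
∏ zero f = 1
∏ (suc n) f = f fzero * ∏ n (λ k → f (fsuc k))

∏≡0⇒factor≡0 : ∀ n (f : Fin n → ℕ) → ∏ n f ≡ 0 → ∃[ k ] f k ≡ 0
∏≡0⇒factor≡0 (suc n) f ∏≡0 with m*n≡0⇒m≡0∨n≡0 (f fzero) ∏≡0
... | inj₁ f0≡0 = fzero , f0≡0
... | inj₂ rest≡0 with ∏≡0⇒factor≡0 n (λ k → f (fsuc k)) rest≡0
...   | k , fk≡0 = fsuc k , fk≡0

sparse-product : ∀ n {A : Set} (E : List A) (P : A → ℕ) c → Sparse c E P →
  Sparse (c ^ n) (allDep n (λ _ → A) (λ _ → E)) (λ g → ∏ n (λ k → P (g k)))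
sparse-product zero E P c sparse = ≤-refl
sparse-product (suc n) {A} E P c sparse = begin
  c * c ^ n * Σl (allDep (suc n) (λ _ → A) (λ _ → E)) (λ g → ∏ (suc n) (λ k → P (g k)))
    ≡⟨ cong (c * c ^ n *_) (trans (Σl-allDep-split n (λ _ → A) (λ _ → E) (λ b g → P b * Q g))
         (Σl-cong E (λ b → Σl-* R (P b) Q))) ⟩
  c * c ^ n * Σl E (λ b → P b * Σl R Q)
    ≡⟨ cong (c * c ^ n *_) (trans (Σl-cong E (λ b → *-comm (P b) _)) (Σl-* E (Σl R Q) P)) ⟩
  c * c ^ n * (Σl R Q * Σl E P)
    ≡⟨ rearrange c (c ^ n) (Σl R Q) (Σl E P) ⟩
  (c * Σl E P) * (c ^ n * Σl R Q)
    ≤⟨ *-mono-≤ sparse (sparse-product n E P c sparse) ⟩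
  length E * length R
    ≡⟨ length-allDep n (λ _ → A) (λ _ → E) ⟨
  length (allDep (suc n) (λ _ → A) (λ _ → E)) ∎
  where
  open ≤-Reasoning
  R = allDep n (λ _ → A) (λ _ → E)
  Q : (Fin n → A) → ℕ
  Q g = ∏ n (λ k → P (g k))
  rearrange : ∀ a b c d → a * b * (c * d) ≡ (a * d) * (b * c)
  rearrange = solve 4 (λ a b c d → a :* b :* (c :* d) := (a :* d) :* (b :* c)) refl
    where open +-*-Solver

∑-snoc : ∀ n (f : ℕ → ℕ) → ∑[ t < suc n ] f (toℕ t) ≡ ∑[ t < n ] f (toℕ t) + f n
∑-snoc n f = trans (sum-init-last (λ t → f (toℕ t)))
  (cong₂ _+_ (sum-cong-≗ {n} (λ t → cong f (toℕ-inject₁ t))) (cong f (toℕ-fromℕ n)))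

levelWeight : ℕ → ℕ → ℕ
levelWeight X t = 𝟙 (2 ^ t <? X) * 2 ^ t

-- The cell sizes below X form a geometric series: their sum is less than
-- 2^n (the sum of all sizes 2^0, …, 2^(n−1)) and at most 2X.
levelWeight-sum : ∀ X n → ∑[ t < n ] levelWeight X (toℕ t) < 2 ^ n × ∑[ t < n ] levelWeight X (toℕ t) ≤ 2 * X
levelWeight-sum X zero = s≤s z≤n , z≤n
levelWeight-sum X (suc n) rewrite ∑-snoc n (levelWeight X) with 2 ^ n <? X | levelWeight-sum X n
... | yes 2^n<X | (S<2^n , _) =
  +-monoˡ-< _ S<2^n , ≤-trans (<⇒≤ (+-monoˡ-< _ S<2^n)) (*-monoʳ-≤ 2 (<⇒≤ 2^n<X))
... | no _ | (S<2^n , S≤2X) =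
  ≤-trans (≤-reflexive (+-identityʳ _)) (≤-trans S<2^n (m≤m+n (2 ^ n) _)) ,
  ≤-trans (≤-reflexive (+-identityʳ _)) S≤2X

minList≤ : ∀ {xs y} → y ∈ xs → minList xs ≤ y
minList≤ {x ∷ xs} = foldr⊓≤ x xs
  where
  foldr⊓≤ : ∀ x xs {y} → y ∈ x ∷ xs → foldr _⊓_ x xs ≤ y
  foldr⊓≤ x [] (here refl) = ≤-refl
  foldr⊓≤ x (z ∷ zs) (here refl) = ≤-trans (m⊓n≤n z _) (foldr⊓≤ x zs (here refl))
  foldr⊓≤ x (z ∷ zs) (there (here refl)) = m⊓n≤m z _
  foldr⊓≤ x (z ∷ zs) (there (there y∈zs)) = ≤-trans (m⊓n≤n z _) (foldr⊓≤ x zs (there y∈zs))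

dist₁-comm : ∀ p q → dist₁ p q ≡ dist₁ q p
dist₁-comm (x , y) (x' , y') = cong₂ _+_ (∣-∣-comm x x') (∣-∣-comm y y')

module Deterministic (L n : ℕ) (S T : Vec Point n) (π : Permutation′ n) (D : List Point)
  (covers : (∀ a → lookup S a ∈ D) ⊎ (∀ a → lookup T a ∈ D)) where

  M : ℕ
  M = 8 * suc (length D)

  radius : ℕ → ℕ
  radius t = 2 ^ t / M

  source target : Fin n → Point
  source a = lookup S a
  target a = lookup T (π ⟨$⟩ʳ a)

  δ : Fin n → ℕ
  δ a = dist₁ (source a) (target a)

  long-edge : ∀ t a → radius t < δ a → 2 ^ t < M * δ a
  long-edge t a r<δ = begin-strict
    2 ^ t                     ≡⟨ m≡m%n+[m/n]*n (2 ^ t) M ⟩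
    2 ^ t % M + radius t * M  <⟨ +-monoˡ-< (radius t * M) (m%n<n (2 ^ t) M) ⟩
    M + radius t * M          ≡⟨ *-comm (suc (radius t)) M ⟩
    M * suc (radius t)        ≤⟨ *-monoʳ-≤ M r<δ ⟩
    M * δ a                   ∎
    where open ≤-Reasoning

  -- A short edge is not cut by a good shift: one of its endpoints is in D
  -- and hence safe.
  short-uncut : ∀ t (sa sb : Fin (2 ^ t)) → GoodShift (radius t) t D (sa , sb) → ∀ a → δ a ≤ radius t →
    cellOf t (toℕ sa) (toℕ sb) (source a) ≡ cellOf t (toℕ sa) (toℕ sb) (target a)
  short-uncut t sa sb good a short = uncut covers
    where
    s = toℕ sa
    s' = toℕ sb
    uncut : (∀ a → lookup S a ∈ D) ⊎ (∀ a → lookup T a ∈ D) → cellOf t s s' (source a) ≡ cellOf t s s' (target a)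
    uncut (inj₁ S⊆D) = sym (same-cell (radius t) t s s' (source a) (target a) (toℕ<n sa) (toℕ<n sb)
      (All.lookup good (S⊆D a)) short)
    uncut (inj₂ T⊆D) = same-cell (radius t) t s s' (target a) (source a) (toℕ<n sa) (toℕ<n sb)
      (All.lookup good (T⊆D (π ⟨$⟩ʳ a))) (subst (_≤ radius t) (dist₁-comm (source a) (target a)) short)

  cut≤levelWeight : ∀ t (sa sb : Fin (2 ^ t)) → GoodShift (radius t) t D (sa , sb) → ∀ a →
    2 ^ t * separates t (toℕ sa) (toℕ sb) (source a) (target a) ≤ levelWeight (M * δ a) t
  cut≤levelWeight t sa sb good a with cellOf t (toℕ sa) (toℕ sb) (source a) ≟P cellOf t (toℕ sa) (toℕ sb) (target a)
  ... | yes _ = ≤-trans (≤-reflexive (*-zeroʳ (2 ^ t))) z≤n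
  ... | no cut with δ a ≤? radius t
  ...   | yes short = ⊥-elim (cut (short-uncut t sa sb good a short))
  ...   | no long = ≤-reflexive (begin-equality
    2 ^ t * 1                      ≡⟨ *-comm (2 ^ t) 1 ⟩
    1 * 2 ^ t                      ≡⟨ cong (_* 2 ^ t) (𝟙-yes (2 ^ t <? M * δ a) (long-edge t a (≰⇒> long))) ⟨
    levelWeight (M * δ a) t        ∎)
    where open ≤-Reasoning

  level≤ : (σ : Shifts L) (i : Fin (suc L)) (j : Fin (2 * L)) → GoodShift (radius (toℕ i)) (toℕ i) D (σ i j) →
    2 ^ toℕ i * Ci L σ S T i ≤ 2 * ∑[ a < n ] levelWeight (M * δ a) (toℕ i)
  level≤ σ i j good = begin
    2 ^ t * Ci L σ S T i
      ≤⟨ *-monoʳ-≤ (2 ^ t) (minList≤ (∈-map⁺ (Cij L σ S T i) (∈-allFin j))) ⟩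
    2 ^ t * gridDiff L t (toℕ sa) (toℕ sb) S T
      ≤⟨ *-monoʳ-≤ (2 ^ t) (gridDiff≤separated L t (toℕ sa) (toℕ sb) n S T π) ⟩
    2 ^ t * (2 * ∑[ a < n ] cut a)
      ≡⟨ x∙yz≈y∙xz-* (2 ^ t) 2 _ ⟩
    2 * (2 ^ t * ∑[ a < n ] cut a)
      ≡⟨ cong (2 *_) (*-distribˡ-sum {n} (2 ^ t) cut) ⟩
    2 * ∑[ a < n ] (2 ^ t * cut a)
      ≤⟨ *-monoʳ-≤ 2 (∑-mono n (cut≤levelWeight t sa sb good)) ⟩
    2 * ∑[ a < n ] levelWeight (M * δ a) t ∎
    where
    open ≤-Reasoning
    t = toℕ i
    sa = proj₁ (σ i j)
    sb = proj₂ (σ i j)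
    cut : Fin n → ℕ
    cut a = separates t (toℕ sa) (toℕ sb) (source a) (target a)

  twiceY≤ : (σ : Shifts L) → (∀ i → ∃[ j ] GoodShift (radius (toℕ i)) (toℕ i) D (σ i j)) →
    twiceY L σ S T ≤ 2 * (2 * (M * matchCost S T π))
  twiceY≤ σ good = begin
    twiceY L σ S T
      ≡⟨ Σl-allFin (suc L) _ ⟩
    ∑[ i < suc L ] (2 ^ toℕ i * Ci L σ S T i)
      ≤⟨ ∑-mono (suc L) (λ i → level≤ σ i (proj₁ (good i)) (proj₂ (good i))) ⟩
    ∑[ i < suc L ] (2 * ∑[ a < n ] W a i)
      ≡⟨ *-distribˡ-sum {suc L} 2 (λ i → ∑[ a < n ] W a i) ⟨
    2 * ∑[ i < suc L ] ∑[ a < n ] W a i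
      ≡⟨ cong (2 *_) (∑-comm {suc L} {n} (λ i a → W a i)) ⟩
    2 * ∑[ a < n ] ∑[ i < suc L ] W a i
      ≤⟨ *-monoʳ-≤ 2 (∑-mono n (λ a → proj₂ (levelWeight-sum (M * δ a) (suc L)))) ⟩
    2 * ∑[ a < n ] (2 * (M * δ a))
      ≡⟨ cong (2 *_) (trans (sym (*-distribˡ-sum {n} 2 (λ a → M * δ a))) (cong (2 *_) (sym (*-distribˡ-sum {n} M δ)))) ⟩
    2 * (2 * (M * ∑[ a < n ] δ a))
      ≡⟨ cong (λ c → 2 * (2 * (M * c))) (Σl-allFin n δ) ⟨
    2 * (2 * (M * matchCost S T π)) ∎
    where
    open ≤-Reasoning
    W : Fin n → Fin (suc L) → ℕ
    W a i = levelWeight (M * δ a) (toℕ i)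

module Probabilistic (L n : ℕ) (S T : Vec Point n) (π : Permutation′ n) (D : List Point)
  (covers : (∀ a → lookup S a ∈ D) ⊎ (∀ a → lookup T a ∈ D)) where

  open Deterministic L n S T π D covers

  allBad : Fin (suc L) → Shifts L → ℕ
  allBad i σ = ∏ (2 * L) (λ j → badShift (radius (toℕ i)) (toℕ i) D (σ i j))

  -- If no level is all bad, the deterministic bound applies.
  exceeds≤allBad : ∀ B → 2 * (2 * (M * matchCost S T π)) ≤ B → ∀ σ →
    𝟙 (¬? (twiceY L σ S T ≤? B)) ≤ ∑[ i < suc L ] allBad i σ
  exceeds≤allBad B bound σ with twiceY L σ S T ≤? B
  ... | yes _ = z≤n
  ... | no exceeds with ∑[ i < suc L ] allBad i σ ≟ 0
  ...   | no nonzero = n≢0⇒n>0 nonzero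
  ...   | yes zero-sum = ⊥-elim (exceeds (≤-trans (twiceY≤ σ good) bound))
    where
    good : ∀ i → ∃[ j ] GoodShift (radius (toℕ i)) (toℕ i) D (σ i j)
    good i with ∏≡0⇒factor≡0 (2 * L) _ (n≤0⇒n≡0 (subst (allBad i σ ≤_) zero-sum (term≤∑ (suc L) (λ i → allBad i σ) i)))
    ... | j , bad≡0 = j , 𝟙¬≡0 (goodShift? (radius (toℕ i)) (toℕ i) D (σ i j)) bad≡0

  radius-small : ∀ t → 8 * length D * radius t ≤ 2 ^ t
  radius-small t = begin
    8 * length D * radius t       ≤⟨ *-monoˡ-≤ (radius t) (*-monoʳ-≤ 8 (n≤1+n (length D))) ⟩
    M * radius t                  ≡⟨ *-comm M (radius t) ⟩
    radius t * M                  ≤⟨ m/n*n≤m (2 ^ t) M ⟩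
    2 ^ t                         ∎
    where open ≤-Reasoning

  -- Each level is all bad with probability at most 2^-(2L): its 2L shifts
  -- are independent and each is bad with probability at most 1/2.
  allBad-sparse : ∀ i → Sparse (2 ^ (2 * L)) (allShifts L) (allBad i)
  allBad-sparse i = sparse-coordinate (suc L) (λ i → Fin (2 * L) → Fin (2 ^ toℕ i) × Fin (2 ^ toℕ i))
    (λ i → allDep (2 * L) (λ _ → Fin (2 ^ toℕ i) × Fin (2 ^ toℕ i)) (λ _ → allPairs (2 ^ toℕ i))) i
    (λ g → ∏ (2 * L) (λ j → badShift (radius t) t D (g j))) (2 ^ (2 * L))
    (sparse-product (2 * L) (allPairs (2 ^ t)) (badShift (radius t) t D) 2 (bad-shifts-sparse (radius t) t D (radius-small t)))
    where t = toℕ i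

  -- Union bound over the L + 1 levels.
  exceeding-count : ∀ B → 2 * (2 * (M * matchCost S T π)) ≤ B →
    2 ^ (2 * L) * length (filter (λ σ → ¬? (twiceY L σ S T ≤? B)) (allShifts L)) ≤ suc L * length (allShifts L)
  exceeding-count B bound = begin
    P * length (filter (λ σ → ¬? (twiceY L σ S T ≤? B)) Ω)
      ≡⟨ cong (P *_) (length-filter-𝟙 _ Ω) ⟩
    P * Σl Ω (λ σ → 𝟙 (¬? (twiceY L σ S T ≤? B)))
      ≤⟨ *-monoʳ-≤ P (Σl-mono Ω (exceeds≤allBad B bound)) ⟩
    P * Σl Ω (λ σ → ∑[ i < suc L ] allBad i σ)
      ≡⟨ cong (P *_) (Σl-∑-comm Ω (suc L) (λ σ i → allBad i σ)) ⟩
    P * ∑[ i < suc L ] Σl Ω (allBad i)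
      ≡⟨ *-distribˡ-sum {suc L} P (λ i → Σl Ω (allBad i)) ⟩
    ∑[ i < suc L ] (P * Σl Ω (allBad i))
      ≤⟨ ∑-mono (suc L) allBad-sparse ⟩
    ∑[ i < suc L ] length Ω
      ≡⟨ ∑-const (suc L) (length Ω) ⟩
    suc L * length Ω ∎
    where
    open ≤-Reasoning
    P = 2 ^ (2 * L)
    Ω = allShifts L

smaller-side : ∀ {n} (S T : Vec Point n) →
  ∃[ D ] ((∀ a → lookup S a ∈ D) ⊎ (∀ a → lookup T a ∈ D)) × length D ≡ kOf S T
smaller-side S T with ≤-total (distinct S) (distinct T)
... | inj₁ S≤T = deduplicate _≟P_ (toList S) , inj₁ (λ a → ∈-deduplicate⁺ _≟P_ (∈-toList⁺ (∈-lookup a S))) ,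
  sym (m≤n⇒m⊓n≡m S≤T)
... | inj₂ T≤S = deduplicate _≟P_ (toList T) , inj₂ (λ a → ∈-deduplicate⁺ _≟P_ (∈-toList⁺ (∈-lookup a T))) ,
  sym (m≥n⇒m⊓n≡n T≤S)

-- k ≥ 1 unless S and T are empty, in which case every matching costs 0.
cost≤k*cost : ∀ n (S T : Vec Point n) (π : Permutation′ n) → matchCost S T π ≤ kOf S T * matchCost S T π
cost≤k*cost zero S T π = z≤n
cost≤k*cost (suc n) (x Vec.∷ S) (y Vec.∷ T) π = m≤n*m _ (kOf (x Vec.∷ S) (y Vec.∷ T))

deterministic-bound≤ : ∀ k d → d ≤ k * d → 2 * (2 * (8 * suc k * d)) ≤ 2 * (32 * k * d)
deterministic-bound≤ k d d≤kd = begin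
  2 * (2 * (8 * suc k * d))   ≡⟨ lhs k d ⟩
  32 * d + 32 * (k * d)       ≤⟨ +-monoˡ-≤ (32 * (k * d)) (*-monoʳ-≤ 32 d≤kd) ⟩
  32 * (k * d) + 32 * (k * d) ≡⟨ rhs k d ⟨
  2 * (32 * k * d)            ∎
  where
  open ≤-Reasoning
  open +-*-Solver
  lhs : ∀ k d → 2 * (2 * (8 * suc k * d)) ≡ 32 * d + 32 * (k * d)
  lhs = solve 2 (λ k d → con 2 :* (con 2 :* (con 8 :* (con 1 :+ k) :* d)) := con 32 :* d :+ con 32 :* (k :* d)) refl
  rhs : ∀ k d → 2 * (32 * k * d) ≡ 32 * (k * d) + 32 * (k * d)
  rhs = solve 2 (λ k d → con 2 :* (con 32 :* k :* d) := con 32 :* (k :* d) :+ con 32 :* (k :* d)) refl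

bound≤32kd : ∀ {n} (S T : Vec Point n) (π : Permutation′ n) (D : List Point) d →
  length D ≡ kOf S T → matchCost S T π ≡ d →
  2 * (2 * (8 * suc (length D) * matchCost S T π)) ≤ 2 * (32 * kOf S T * d)
bound≤32kd {n} S T π D d |D|≡k refl rewrite |D|≡k =
  deterministic-bound≤ (kOf S T) (matchCost S T π) (cost≤k*cost n S T π)

1+L≤2^L : ∀ L → suc L ≤ 2 ^ L
1+L≤2^L zero = ≤-refl
1+L≤2^L (suc L) = +-mono-≤ (m^n>0 2 L) (≤-trans (1+L≤2^L L) (m≤m+n (2 ^ L) 0))

-- The failure probability (L + 1) / 4^L is at most 1/(m + 1) once L > m.
levels≤4^L : ∀ m L → suc m ≤ L → suc m * suc L ≤ 2 ^ (2 * L)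
levels≤4^L m L m<L = begin
  suc m * suc L   ≤⟨ *-monoˡ-≤ (suc L) (m≤n⇒m≤1+n m<L) ⟩
  suc L * suc L   ≤⟨ *-mono-≤ (1+L≤2^L L) (1+L≤2^L L) ⟩
  2 ^ L * 2 ^ L   ≡⟨ ^-distribˡ-+-* 2 L L ⟨
  2 ^ (L + L)     ≡⟨ cong (λ e → 2 ^ (L + e)) (+-identityʳ L) ⟨
  2 ^ (2 * L)     ∎
  where open ≤-Reasoning

-- Only the matching achieving EMD(S,T) is used.
lemma1 : ∃[ c ] ((m : ℕ) → ∃[ L₀ ] ((L : ℕ) → L₀ ≤ L →
           (n : ℕ) (S T : Vec Point n) →
           ((a : Fin n) → InGrid (2 ^ L) (lookup S a) × InGrid (2 ^ L) (lookup T a)) →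
           ((a b : Fin n) → lookup S a ≢ lookup T b) →
           (d : ℕ) → IsEMD S T d →
           suc m * length (badShifts L c d S T) ≤ length (allShifts L)))
lemma1 = 32 , λ m → suc m , λ L m<L n S T _ _ d ((π , cost≡d) , _) →
  let (D , covers , |D|≡k) = smaller-side S T
      P = 2 ^ (2 * L)
      bad = length (badShifts L 32 d S T)
      all = length (allShifts L)
  in *-cancelˡ-≤ P {{m^n≢0 2 (2 * L)}} (begin
    P * (suc m * bad)     ≡⟨ x∙yz≈y∙xz-* P (suc m) bad ⟩
    suc m * (P * bad)     ≤⟨ *-monoʳ-≤ (suc m) (Probabilistic.exceeding-count L n S T π D covers _ (bound≤32kd S T π D d |D|≡k cost≡d)) ⟩
    suc m * (suc L * all) ≡⟨ *-assoc (suc m) (suc L) all ⟨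
    suc m * suc L * all   ≤⟨ *-monoˡ-≤ all (levels≤4^L m L m<L) ⟩
    P * all               ∎)
  where open ≤-Reasoning
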